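{- Let $q$ be a prime power, $k\ge 3$ an integer and $a_0,a_1,a_2\in\mathbb{F}_{q^k}$. For $\epsilon\in\{1,-1\}$ let $D_\epsilon$ be the $k\times k$ matrix with rows and columns indexed by $0,\dots,k-1$ whose entries are defined as follows: for each row $i$ and each $t\in\{0,1,2\}$, the entry in position $(i,\,(i+t)\bmod k)$ is $a_t^{q^i}$ if $i+t\le k-1$ and $\epsilon\, a_t^{q^i}$ if $i+t\ge k$; all other entries are $0$. (Thus the first row is $(a_0,a_1,a_2,0,\dots,0)$, the row of index $k-2$ is $(\epsilon a_2^{q^{k-2}},0,\dots,0,a_0^{q^{k-2}},a_1^{q^{k-2}})$ and the last row is $(\epsilon a_1^{q^{k-1}},\epsilon a_2^{q^{k-1}},0,\dots,0,a_0^{q^{k-1}})$.) Then $\det D_1+\det D_{ -1}=2\left(\mathrm{N}_{q^k/q}(a_0)+\mathrm{N}_{q^k/q}(a_2)\right)$.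
   Context: $\mathrm{N}_{q^{k}/q}(x)=x^{q^{k-1}+\dots+q+1}$ denotes the norm of $x\in\mathbb{F}_{q^k}$ over $\mathbb{F}_q$. -}

module Defs where

open import Level using (Level; _⊔_)
open import Algebra.Bundles using (CommutativeRing)
open import Data.Nat as ℕ using (ℕ; zero; suc)
open import Data.Nat.Primality using (Prime)
open import Data.Fin using (Fin; zero; suc; toℕ; punchIn)
open import Data.Product using (∃; _×_)
open import Relation.Nullary using (¬_; yes; no)
open import Relation.Binary.PropositionalEquality as P using (_≡_)
open import Function.Bundles using (Inverse)

IsPrimePower : ℕ → Set
IsPrimePower q = ∃ λ p → ∃ λ n → Prime p × q ≡ p ℕ.^ suc n

module _ {c ℓ : Level} (R : CommutativeRing c ℓ) where
  open CommutativeRing R hiding (zero)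

  record IsField : Set (c ⊔ ℓ) where
    field
      0≉1 : ¬ (0# ≈ 1#)
      inverse : ∀ x → ¬ (x ≈ 0#) → ∃ λ y → (x * y) ≈ 1#

  HasCardinality : ℕ → Set (c ⊔ ℓ)
  HasCardinality m = Inverse setoid (P.setoid (Fin m))

  pow : Carrier → ℕ → Carrier
  pow x zero = 1#
  pow x (suc n) = x * pow x n

  sumFin : ∀ n → (Fin n → Carrier) → Carrier
  sumFin zero f = 0#
  sumFin (suc n) f = f zero + sumFin n (λ i → f (suc i))

  prodFin : ∀ n → (Fin n → Carrier) → Carrier
  prodFin zero f = 1#
  prodFin (suc n) f = f zero * prodFin n (λ i → f (suc i))

  altSign : ℕ → Carrier
  altSign zero = 1#
  altSign (suc j) = - altSign j

  det : ∀ n → (Fin n → Fin n → Carrier) → Carrier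
  det zero M = 1#
  det (suc n) M =
    sumFin (suc n) (λ j → altSign (toℕ j) * (M zero j * det n (λ r s → M (suc r) (punchIn j s))))

  -- norm N_{q^k/q}(x) = x^(q^{k-1} + ... + q + 1) = ∏_{i<k} x^(q^i)
  norm : ℕ → ℕ → Carrier → Carrier
  norm q k x = pow x (sumℕ k)
    where
    sumℕ : ℕ → ℕ
    sumℕ zero = zero
    sumℕ (suc i) = q ℕ.^ i ℕ.+ sumℕ i

  -- the matrix D_ε (ε a ring element, used with ε = 1 and ε = -1):
  -- entry (i, j) is the sum over t ∈ {0,1,2} of
  --   a_t^(q^i)      if j = i + t          (i + t ≤ k-1)
  --   ε a_t^(q^i)    if j + k = i + t      (i + t ≥ k, column (i+t) mod k)
  -- and 0 otherwise (for k ≥ 3 at most one t contributes).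
  Dmat : (q k : ℕ) (ε a₀ a₁ a₂ : Carrier) → Fin k → Fin k → Carrier
  Dmat q k ε a₀ a₁ a₂ i j = term 0 a₀ + (term 1 a₁ + term 2 a₂)
    where
    term : ℕ → Carrier → Carrier
    term t a with toℕ j ℕ.≟ toℕ i ℕ.+ t | toℕ j ℕ.+ k ℕ.≟ toℕ i ℕ.+ t
    ... | yes _ | _     = pow a (q ℕ.^ toℕ i)
    ... | no _  | yes _ = ε * pow a (q ℕ.^ toℕ i)
    ... | no _  | no _  = 0#

{-# OPTIONS --safe #-}
-- Split D_ε = U + ε W, where U keeps the entries a_t^(q^i) at (i, i + t) and W the entries that wrap
-- around to (i, i + t - k).  W lives in columns 0 and 1 only, so expanding det D_ε multilinearly in
-- those two columns makes it a quadratic det U + ε X + ε² det E in ε, where E takes columns 0, 1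
-- from W and the others from U; hence det D_1 + det D_-1 = 2 (det U + det E).  U is upper triangular
-- with diagonal a₀^(q^i), so det U = N(a₀).  Read in the column order 2, …, k - 1, 0, 1, E is lower
-- triangular with diagonal a₂^(q^i), and every Laplace step along the first row picks column 2, with
-- sign +1; so det E = N(a₂).
module Submission where

open import Defs
open import Level using (Level)
open import Algebra.Bundles using (CommutativeRing)
import Data.Nat.Properties as ℕₚ
open import Data.Nat as ℕ using (ℕ; zero; suc; _≤_; _<_; _^_; _≟_; z≤n; s≤s)
open import Data.Fin using (Fin; toℕ; punchIn; punchOut) renaming (zero to fzero; suc to fsuc)
import Data.Fin as Fin
open import Data.Fin.Properties using (punchIn-punchOut; punchInᵢ≢i; punchIn-injective; suc-injective; toℕ<n)
open import Function using (_∘_)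
open import Relation.Nullary using (Dec; yes; no)
open import Relation.Binary.PropositionalEquality as ≡ using (_≡_; _≢_)
open import Data.Empty using (⊥-elim)
import Algebra.Solver.Ring.NaturalCoefficients.Default as NaturalCoefficients
import Algebra.Properties.Ring as RingProperties
import Relation.Binary.Reasoning.Setoid as SetoidReasoning

module Determinant {c ℓ : Level} (R : CommutativeRing c ℓ) where
  open CommutativeRing R hiding (zero)
  open SetoidReasoning setoid
  open NaturalCoefficients commutativeSemiring using (solve; _:+_; _:*_; _:=_; con)
  open RingProperties ring using (-1*x≈-x; -‿involutive)

  Column : ℕ → Set c
  Column n = Fin n → Carrier

  Matrix : ℕ → Set c
  Matrix n = Fin n → Column n

  minor : ∀ {n} → Matrix (suc n) → Fin (suc n) → Matrix n
  minor M j r s = M (fsuc r) (punchIn j s)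

  laplaceTerm : ∀ {n} → Matrix (suc n) → Fin (suc n) → Carrier
  laplaceTerm {n} M j = altSign R (toℕ j) * (M fzero j * det R n (minor M j))

  sumFin-cong : ∀ n {f g : Fin n → Carrier} → (∀ i → f i ≈ g i) → sumFin R n f ≈ sumFin R n g
  sumFin-cong zero    f≈g = refl
  sumFin-cong (suc n) f≈g = +-cong (f≈g fzero) (sumFin-cong n (λ i → f≈g (fsuc i)))

  sumFin-≈0 : ∀ n {f : Fin n → Carrier} → (∀ i → f i ≈ 0#) → sumFin R n f ≈ 0#
  sumFin-≈0 zero    f≈0 = refl
  sumFin-≈0 (suc n) f≈0 = trans (+-cong (f≈0 fzero) (sumFin-≈0 n (λ i → f≈0 (fsuc i)))) (+-identityʳ 0#)

  sumFin-single : ∀ {n} (j : Fin n) (f : Fin n → Carrier) → (∀ i → i ≢ j → f i ≈ 0#) → sumFin R n f ≈ f j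
  sumFin-single {suc n} fzero    f f≈0 =
    trans (+-congˡ (sumFin-≈0 n (λ i → f≈0 (fsuc i) (λ ())))) (+-identityʳ _)
  sumFin-single {suc n} (fsuc j) f f≈0 =
    trans (+-cong (f≈0 fzero (λ ())) (sumFin-single j (λ i → f (fsuc i)) (λ i i≢j → f≈0 (fsuc i) (i≢j ∘ suc-injective))))
          (+-identityˡ _)

  sumFin-linear : ∀ n (f g : Fin n → Carrier) ε →
                  sumFin R n (λ i → f i + ε * g i) ≈ sumFin R n f + ε * sumFin R n g
  sumFin-linear zero    f g ε = sym (trans (+-identityˡ _) (zeroʳ ε))
  sumFin-linear (suc n) f g ε =
    trans (+-congˡ (sumFin-linear n (λ i → f (fsuc i)) (λ i → g (fsuc i)) ε)) (regroup _ _ _ _ _)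
    where
    regroup : ∀ a b ε c d → (a + ε * b) + (c + ε * d) ≈ (a + c) + ε * (b + d)
    regroup = solve 5 (λ a b ε c d → (a :+ ε :* b) :+ (c :+ ε :* d) := (a :+ c) :+ ε :* (b :+ d)) refl

  det-cong : ∀ n {M N : Matrix n} → (∀ i j → M i j ≈ N i j) → det R n M ≈ det R n N
  det-cong zero    M≈N = refl
  det-cong (suc n) M≈N = sumFin-cong (suc n) λ j →
    *-congˡ {altSign R (toℕ j)} (*-cong (M≈N fzero j) (det-cong n (λ r s → M≈N (fsuc r) (punchIn j s))))

  det-linear-in-column : ∀ {n} (c : Fin n) {M M₁ M₂ : Matrix n} ε →
    (∀ i j → j ≢ c → M i j ≈ M₁ i j) → (∀ i j → j ≢ c → M₂ i j ≈ M₁ i j) →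
    (∀ i → M i c ≈ M₁ i c + ε * M₂ i c) → det R n M ≈ det R n M₁ + ε * det R n M₂
  det-linear-in-column {suc n} c {M} {M₁} {M₂} ε M≈M₁ M₂≈M₁ M≈M₁+εM₂ =
    trans (sumFin-cong (suc n) expand-term) (sumFin-linear (suc n) (laplaceTerm M₁) (laplaceTerm M₂) ε)
    where
    expand-term : ∀ j → laplaceTerm M j ≈ laplaceTerm M₁ j + ε * laplaceTerm M₂ j
    expand-term j with j Fin.≟ c
    ... | yes ≡.refl = begin
      s * (M fzero j * det R n (minor M j))
        ≈⟨ *-congˡ (*-cong (M≈M₁+εM₂ fzero) (det-cong n (λ r t → M≈M₁ (fsuc r) _ (punchInᵢ≢i j t)))) ⟩
      s * ((M₁ fzero j + ε * M₂ fzero j) * det R n (minor M₁ j))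
        ≈⟨ distribute-column _ _ _ _ _ ⟩
      s * (M₁ fzero j * det R n (minor M₁ j)) + ε * (s * (M₂ fzero j * det R n (minor M₁ j)))
        ≈⟨ +-congˡ (*-congˡ (*-congˡ (*-congˡ (det-cong n (λ r t → sym (M₂≈M₁ (fsuc r) _ (punchInᵢ≢i j t))))))) ⟩
      s * (M₁ fzero j * det R n (minor M₁ j)) + ε * (s * (M₂ fzero j * det R n (minor M₂ j)))
        ∎
      where
      s : Carrier
      s = altSign R (toℕ j)
      distribute-column : ∀ s a ε b d → s * ((a + ε * b) * d) ≈ s * (a * d) + ε * (s * (b * d))
      distribute-column = solve 5 (λ s a ε b d →
        s :* ((a :+ ε :* b) :* d) := s :* (a :* d) :+ ε :* (s :* (b :* d))) refl
    ... | no j≢c = begin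
      s * (M fzero j * det R n (minor M j))
        ≈⟨ *-congˡ (*-cong (M≈M₁ fzero j j≢c) minor-linear) ⟩
      s * (M₁ fzero j * (det R n (minor M₁ j) + ε * det R n (minor M₂ j)))
        ≈⟨ distribute-minor _ _ _ _ _ ⟩
      s * (M₁ fzero j * det R n (minor M₁ j)) + ε * (s * (M₁ fzero j * det R n (minor M₂ j)))
        ≈⟨ +-congˡ (*-congˡ (*-congˡ (*-congʳ (sym (M₂≈M₁ fzero j j≢c))))) ⟩
      s * (M₁ fzero j * det R n (minor M₁ j)) + ε * (s * (M₂ fzero j * det R n (minor M₂ j)))
        ∎
      where
      s : Carrier
      s = altSign R (toℕ j)
      distribute-minor : ∀ s a ε d₁ d₂ → s * (a * (d₁ + ε * d₂)) ≈ s * (a * d₁) + ε * (s * (a * d₂))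
      distribute-minor = solve 5 (λ s a ε d₁ d₂ →
        s :* (a :* (d₁ :+ ε :* d₂)) := s :* (a :* d₁) :+ ε :* (s :* (a :* d₂))) refl
      c′ : Fin n
      c′ = punchOut j≢c
      avoids-c : ∀ t → t ≢ c′ → punchIn j t ≢ c
      avoids-c t t≢c′ eq = t≢c′ (punchIn-injective j t c′ (≡.trans eq (≡.sym (punchIn-punchOut j≢c))))
      minor-linear : det R n (minor M j) ≈ det R n (minor M₁ j) + ε * det R n (minor M₂ j)
      minor-linear = det-linear-in-column c′ ε
        (λ r t t≢c′ → M≈M₁ (fsuc r) _ (avoids-c t t≢c′))
        (λ r t t≢c′ → M₂≈M₁ (fsuc r) _ (avoids-c t t≢c′))
        (λ r → ≡.subst (λ x → M (fsuc r) x ≈ M₁ (fsuc r) x + ε * M₂ (fsuc r) x)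
                       (≡.sym (punchIn-punchOut j≢c)) (M≈M₁+εM₂ (fsuc r)))

  -- A zero column equals itself plus (-1) times itself.
  det-zero-column : ∀ {n} (c : Fin n) {M : Matrix n} → (∀ i → M i c ≈ 0#) → det R n M ≈ 0#
  det-zero-column c {M} Mc≈0 =
    trans (det-linear-in-column c {M} {M} {M} (- 1#) (λ _ _ _ → refl) (λ _ _ _ → refl) column)
          (trans (+-congˡ (-1*x≈-x _)) (-‿inverseʳ _))
    where
    column : ∀ i → M i c ≈ M i c + - 1# * M i c
    column i = trans (Mc≈0 i)
      (sym (trans (+-cong (Mc≈0 i) (trans (*-congˡ (Mc≈0 i)) (zeroʳ _))) (+-identityʳ 0#)))

  det-single-entry-row : ∀ {n} (j : Fin (suc n)) {M : Matrix (suc n)} → (∀ j′ → j′ ≢ j → M fzero j′ ≈ 0#) →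
                         det R (suc n) M ≈ altSign R (toℕ j) * (M fzero j * det R n (minor M j))
  det-single-entry-row j {M} M₀≈0 = sumFin-single j (laplaceTerm M) λ j′ j′≢j →
    trans (*-congˡ (trans (*-congʳ (M₀≈0 j′ j′≢j)) (zeroˡ _))) (zeroʳ _)

  det-minor-keeping-zero-column : ∀ {n} {M : Matrix (suc n)} (j : Fin n) → (∀ r → M (fsuc r) fzero ≈ 0#) →
                                  det R n (minor M (fsuc j)) ≈ 0#
  det-minor-keeping-zero-column {suc _} {M} j M₀≈0 = det-zero-column fzero {minor M (fsuc j)} M₀≈0

  det-upper-triangular : ∀ n {M : Matrix n} → (∀ i j → toℕ j < toℕ i → M i j ≈ 0#) →
                         det R n M ≈ prodFin R n (λ i → M i i)
  det-upper-triangular zero    below≈0 = refl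
  det-upper-triangular (suc n) {M} below≈0 =
    trans (sumFin-single fzero (laplaceTerm M) later-terms≈0)
          (trans (*-identityˡ _)
                 (*-congˡ (det-upper-triangular n (λ i j j<i → below≈0 (fsuc i) (fsuc j) (s≤s j<i)))))
    where
    later-terms≈0 : ∀ j → j ≢ fzero → laplaceTerm M j ≈ 0#
    later-terms≈0 fzero    0≢0 = ⊥-elim (0≢0 ≡.refl)
    later-terms≈0 (fsuc j) _   = trans (*-congˡ (trans (*-congˡ
      (det-minor-keeping-zero-column {M = M} j (λ r → below≈0 (fsuc r) fzero (s≤s z≤n)))) (zeroʳ _))) (zeroʳ _)

  withColumns₀₁ : ∀ {n} → Matrix (suc (suc n)) → (u v : Column (suc (suc n))) → Matrix (suc (suc n))
  withColumns₀₁ M u v i fzero           = u i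
  withColumns₀₁ M u v i (fsuc fzero)    = v i
  withColumns₀₁ M u v i (fsuc (fsuc j)) = M i (fsuc (fsuc j))

  withColumns₀₁-own : ∀ {n} (M : Matrix (suc (suc n))) i j →
                      withColumns₀₁ M (λ r → M r fzero) (λ r → M r (fsuc fzero)) i j ≡ M i j
  withColumns₀₁-own M i fzero           = ≡.refl
  withColumns₀₁-own M i (fsuc fzero)    = ≡.refl
  withColumns₀₁-own M i (fsuc (fsuc j)) = ≡.refl

  det-affine-in-columns₀₁ : ∀ {n} (M : Matrix (suc (suc n))) (u w u′ w′ : Column (suc (suc n))) ε →
    let D : Column (suc (suc n)) → Column (suc (suc n)) → Carrier
        D x y = det R (suc (suc n)) (withColumns₀₁ M x y)
    in D (λ i → u i + ε * w i) (λ i → u′ i + ε * w′ i) ≈ D u u′ + ε * (D w u′ + D u w′) + (ε * ε) * D w w′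
  det-affine-in-columns₀₁ {n} M u w u′ w′ ε = begin
    D (u +ε w) (u′ +ε w′)                                  ≈⟨ linear-in-column₀ (u′ +ε w′) ⟩
    D u (u′ +ε w′) + ε * D w (u′ +ε w′)                    ≈⟨ +-cong (linear-in-column₁ u) (*-congˡ (linear-in-column₁ w)) ⟩
    (D u u′ + ε * D u w′) + ε * (D w u′ + ε * D w w′)      ≈⟨ collect _ _ _ _ ε ⟩
    D u u′ + ε * (D w u′ + D u w′) + (ε * ε) * D w w′      ∎
    where

    D : Column (suc (suc n)) → Column (suc (suc n)) → Carrier
    D x y = det R (suc (suc n)) (withColumns₀₁ M x y)

    _+ε_ : Column (suc (suc n)) → Column (suc (suc n)) → Column (suc (suc n))
    (x +ε y) i = x i + ε * y i

    linear-in-column₀ : ∀ y → D (u +ε w) y ≈ D u y + ε * D w y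
    linear-in-column₀ y = det-linear-in-column fzero ε off-column off-column (λ _ → refl)
      where
      off-column : ∀ {x x′} i j → j ≢ fzero → withColumns₀₁ M x y i j ≈ withColumns₀₁ M x′ y i j
      off-column i fzero            0≢0 = ⊥-elim (0≢0 ≡.refl)
      off-column i (fsuc fzero)     _   = refl
      off-column i (fsuc (fsuc j))  _   = refl

    linear-in-column₁ : ∀ x → D x (u′ +ε w′) ≈ D x u′ + ε * D x w′
    linear-in-column₁ x = det-linear-in-column (fsuc fzero) ε off-column off-column (λ _ → refl)
      where
      off-column : ∀ {y y′} i j → j ≢ fsuc fzero → withColumns₀₁ M x y i j ≈ withColumns₀₁ M x y′ i j
      off-column i fzero            _   = refl
      off-column i (fsuc fzero)     1≢1 = ⊥-elim (1≢1 ≡.refl)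
      off-column i (fsuc (fsuc j))  _   = refl

    collect : ∀ a b c d ε → (a + ε * b) + ε * (c + ε * d) ≈ a + ε * (c + b) + (ε * ε) * d
    collect = solve 5 (λ a b c d ε → (a :+ ε :* b) :+ ε :* (c :+ ε :* d) := a :+ ε :* (c :+ b) :+ (ε :* ε) :* d) refl

  -- Position of column j in the cyclic order 2, 3, …, p + 1, 0, 1.
  rotatedTwice : ∀ {p} → Fin (suc (suc p)) → ℕ
  rotatedTwice {p} fzero           = p
  rotatedTwice {p} (fsuc fzero)    = suc p
  rotatedTwice     (fsuc (fsuc j)) = toℕ j

  det-rotated-lower-triangular : ∀ p {M : Matrix (suc (suc p))} (g : Fin (suc (suc p)) → Carrier) →
    (∀ i j → toℕ i < rotatedTwice j → M i j ≈ 0#) → (∀ i j → rotatedTwice j ≡ toℕ i → M i j ≈ g i) →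
    det R (suc (suc p)) M ≈ prodFin R (suc (suc p)) g
  det-rotated-lower-triangular zero {M} g above≈0 pivot≈g = begin
    det R 2 M
      ≈⟨ det-single-entry-row fzero {M} row₀ ⟩
    1# * (M fzero fzero * (1# * (M (fsuc fzero) (fsuc fzero) * 1#) + 0#))
      ≈⟨ *-congˡ (*-cong (pivot≈g fzero fzero ≡.refl)
                         (+-congʳ (*-congˡ (*-congʳ (pivot≈g (fsuc fzero) (fsuc fzero) ≡.refl))))) ⟩
    1# * (g fzero * (1# * (g (fsuc fzero) * 1#) + 0#))
      ≈⟨ drop-units _ _ ⟩
    g fzero * (g (fsuc fzero) * 1#)
      ∎
    where
    row₀ : ∀ j → j ≢ fzero → M fzero j ≈ 0#
    row₀ fzero        0≢0 = ⊥-elim (0≢0 ≡.refl)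
    row₀ (fsuc fzero) _   = above≈0 fzero (fsuc fzero) (s≤s z≤n)
    drop-units : ∀ a b → 1# * (a * (1# * (b * 1#) + 0#)) ≈ a * (b * 1#)
    drop-units = solve 2 (λ a b → con 1 :* (a :* (con 1 :* (b :* con 1) :+ con 0)) := a :* (b :* con 1)) refl
  det-rotated-lower-triangular (suc p) {M} g above≈0 pivot≈g = begin
    det R (suc (suc (suc p))) M
      ≈⟨ det-single-entry-row column₂ {M} row₀ ⟩
    - - 1# * (M fzero column₂ * det R (suc (suc p)) (minor M column₂))
      ≈⟨ *-cong (-‿involutive 1#) (*-cong (pivot≈g fzero column₂ ≡.refl) minor≈prod) ⟩
    1# * (g fzero * prodFin R (suc (suc p)) (λ i → g (fsuc i)))
      ≈⟨ *-identityˡ _ ⟩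
    prodFin R (suc (suc (suc p))) g
      ∎
    where
    column₂ : Fin (suc (suc (suc p)))
    column₂ = fsuc (fsuc fzero)
    row₀ : ∀ j → j ≢ column₂ → M fzero j ≈ 0#
    row₀ fzero                    _   = above≈0 fzero fzero (s≤s z≤n)
    row₀ (fsuc fzero)             _   = above≈0 fzero (fsuc fzero) (s≤s z≤n)
    row₀ (fsuc (fsuc fzero))      2≢2 = ⊥-elim (2≢2 ≡.refl)
    row₀ (fsuc (fsuc (fsuc j)))   _   = above≈0 fzero (fsuc (fsuc (fsuc j))) (s≤s z≤n)
    -- rotatedTwice (punchIn column₂ s) reduces to suc (rotatedTwice s) once s is split.
    minor≈prod : det R (suc (suc p)) (minor M column₂) ≈ prodFin R (suc (suc p)) (λ i → g (fsuc i))
    minor≈prod = det-rotated-lower-triangular p {minor M column₂} (λ i → g (fsuc i)) above pivot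
      where
      above : ∀ i j → toℕ i < rotatedTwice j → minor M column₂ i j ≈ 0#
      above i fzero           i<   = above≈0 (fsuc i) fzero (s≤s i<)
      above i (fsuc fzero)    i<   = above≈0 (fsuc i) (fsuc fzero) (s≤s i<)
      above i (fsuc (fsuc j)) i<   = above≈0 (fsuc i) (fsuc (fsuc (fsuc j))) (s≤s i<)
      pivot : ∀ i j → rotatedTwice j ≡ toℕ i → minor M column₂ i j ≈ g (fsuc i)
      pivot i fzero           eq = pivot≈g (fsuc i) fzero (≡.cong suc eq)
      pivot i (fsuc fzero)    eq = pivot≈g (fsuc i) (fsuc fzero) (≡.cong suc eq)
      pivot i (fsuc (fsuc j)) eq = pivot≈g (fsuc i) (fsuc (fsuc (fsuc j))) (≡.cong suc eq)

module NormAsProduct {c ℓ : Level} (R : CommutativeRing c ℓ) where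
  open CommutativeRing R hiding (zero)
  open SetoidReasoning setoid

  pow-+ : ∀ x m n → pow R x (m ℕ.+ n) ≈ pow R x m * pow R x n
  pow-+ x zero    n = sym (*-identityˡ _)
  pow-+ x (suc m) n = trans (*-congˡ (pow-+ x m n)) (sym (*-assoc _ _ _))

  prodFin-cong : ∀ n {f g : Fin n → Carrier} → (∀ i → f i ≈ g i) → prodFin R n f ≈ prodFin R n g
  prodFin-cong zero    f≈g = refl
  prodFin-cong (suc n) f≈g = *-cong (f≈g fzero) (prodFin-cong n (λ i → f≈g (fsuc i)))

  prodFin-snoc : ∀ n (g : ℕ → Carrier) → prodFin R (suc n) (g ∘ toℕ) ≈ prodFin R n (g ∘ toℕ) * g n
  prodFin-snoc zero    g = *-comm _ _
  prodFin-snoc (suc n) g = trans (*-congˡ (prodFin-snoc n (g ∘ suc))) (sym (*-assoc _ _ _))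

  norm≈prodFin : ∀ q k a → norm R q k a ≈ prodFin R k (λ i → pow R a (q ^ toℕ i))
  norm≈prodFin q zero    a = refl
  norm≈prodFin q (suc k) a = begin
    norm R q (suc k) a              ≈⟨ pow-+ a (q ^ k) _ ⟩
    g k * norm R q k a              ≈⟨ *-comm _ _ ⟩
    norm R q k a * g k              ≈⟨ *-congʳ (norm≈prodFin q k a) ⟩
    prodFin R k (g ∘ toℕ) * g k     ≈⟨ prodFin-snoc k g ⟨
    prodFin R (suc k) (g ∘ toℕ)     ∎
    where
    g : ℕ → Carrier
    g n = pow R a (q ^ n)

module Signs {c ℓ : Level} (R : CommutativeRing c ℓ) where
  open CommutativeRing R hiding (zero)
  open SetoidReasoning setoid
  open NaturalCoefficients commutativeSemiring using (solve; _:+_; _:*_; _:=_; con)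
  open RingProperties ring using (-1*x≈-x; -‿involutive)

  sum-at-±1 : ∀ a b c → (a + 1# * b + (1# * 1#) * c) + (a + - 1# * b + (- 1# * - 1#) * c) ≈ (1# + 1#) * (a + c)
  sum-at-±1 a b c = begin
    (a + 1# * b + (1# * 1#) * c) + (a + - 1# * b + (- 1# * - 1#) * c)
      ≈⟨ +-congˡ (+-congˡ (*-congʳ (trans (-1*x≈-x (- 1#)) (-‿involutive 1#)))) ⟩
    (a + 1# * b + (1# * 1#) * c) + (a + - 1# * b + 1# * c)
      ≈⟨ collect a b c (- 1#) ⟩
    (1# + 1#) * (a + c) + (1# + - 1#) * b
      ≈⟨ +-congˡ (trans (*-congʳ (-‿inverseʳ 1#)) (zeroˡ b)) ⟩
    (1# + 1#) * (a + c) + 0#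
      ≈⟨ +-identityʳ _ ⟩
    (1# + 1#) * (a + c)
      ∎
    where
    collect : ∀ a b c e → (a + 1# * b + (1# * 1#) * c) + (a + e * b + 1# * c) ≈ (1# + 1#) * (a + c) + (1# + e) * b
    collect = solve 4 (λ a b c e → (a :+ con 1 :* b :+ (con 1 :* con 1) :* c) :+ (a :+ e :* b :+ con 1 :* c)
                                   := (con 1 :+ con 1) :* (a :+ c) :+ (con 1 :+ e) :* b) refl

beyond-reach : ∀ {n i t} → t ≤ 2 → suc (suc i) < n → n ≢ i ℕ.+ t
beyond-reach {n} {i} {t} t≤2 2+i<n = ℕₚ.>⇒≢ (begin-strict
  i ℕ.+ t  ≤⟨ ℕₚ.+-monoʳ-≤ i t≤2 ⟩
  i ℕ.+ 2  ≡⟨ ℕₚ.+-comm i 2 ⟩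
  2 ℕ.+ i  <⟨ 2+i<n ⟩
  n        ∎)
  where open ℕₚ.≤-Reasoning

before-reach : ∀ {n i} t → n < i → n ≢ i ℕ.+ t
before-reach {i = i} t n<i = ℕₚ.<⇒≢ (ℕₚ.<-≤-trans n<i (ℕₚ.m≤m+n i t))

other-offset : ∀ {n} i s t → n ≡ i ℕ.+ s → s ≢ t → n ≢ i ℕ.+ t
other-offset i s t n≡i+s s≢t n≡i+t = s≢t (ℕₚ.+-cancelˡ-≡ i _ _ (≡.trans (≡.sym n≡i+s) n≡i+t))

two-further : ∀ {n i} → n ≡ i → suc (suc n) ≡ i ℕ.+ 2
two-further {i = i} n≡i = ≡.trans (≡.cong (λ x → suc (suc x)) n≡i) (ℕₚ.+-comm 2 i)

module DMatrix {c ℓ : Level} (F : CommutativeRing c ℓ) (q m : ℕ) (a₀ a₁ a₂ : CommutativeRing.Carrier F) where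
  open CommutativeRing F hiding (zero)
  open Determinant F
  open SetoidReasoning setoid
  open NormAsProduct F
  open NaturalCoefficients commutativeSemiring using (solve; _:+_; _:*_; _:=_)

  k : ℕ
  k = suc (suc (suc m))

  sum₃ : (ℕ → Carrier → Carrier) → Carrier
  sum₃ f = f 0 a₀ + (f 1 a₁ + f 2 a₂)

  sum₃-≈0 : ∀ {f} → (∀ t a → t ≤ 2 → f t a ≈ 0#) → sum₃ f ≈ 0#
  sum₃-≈0 f≈0 = trans (+-cong (f≈0 0 a₀ z≤n) (+-cong (f≈0 1 a₁ (s≤s z≤n)) (f≈0 2 a₂ (s≤s (s≤s z≤n)))))
                      (trans (+-identityˡ _) (+-identityˡ 0#))

  power : Carrier → Fin k → Carrier
  power a i = pow F a (q ^ toℕ i)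

  inPlace? : ∀ t (i j : Fin k) → Dec (toℕ j ≡ toℕ i ℕ.+ t)
  inPlace? t i j = toℕ j ≟ toℕ i ℕ.+ t

  wrapped? : ∀ t (i j : Fin k) → Dec (toℕ j ℕ.+ k ≡ toℕ i ℕ.+ t)
  wrapped? t i j = toℕ j ℕ.+ k ≟ toℕ i ℕ.+ t

  -- Dmat's local `term`, with its two tests named.
  contributionAt : Carrier → ℕ → Carrier → Fin k → Fin k → Carrier
  contributionAt ε t a i j with inPlace? t i j | wrapped? t i j
  ... | yes _ | _     = power a i
  ... | no _  | yes _ = ε * power a i
  ... | no _  | no _  = 0#

  wrapPartAt : ℕ → Carrier → Fin k → Fin k → Carrier
  wrapPartAt t a i j with inPlace? t i j | wrapped? t i j
  ... | yes _ | _     = 0#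
  ... | no _  | yes _ = power a i
  ... | no _  | no _  = 0#

  contributionAt-split : ∀ ε t a i j → contributionAt ε t a i j ≈ contributionAt 0# t a i j + ε * wrapPartAt t a i j
  contributionAt-split ε t a i j with inPlace? t i j | wrapped? t i j
  ... | yes _ | _     = sym (trans (+-congˡ (zeroʳ ε)) (+-identityʳ _))
  ... | no _  | yes _ = sym (trans (+-congʳ (zeroˡ _)) (+-identityˡ _))
  ... | no _  | no _  = sym (trans (+-identityˡ _) (zeroʳ ε))

  contributionAt-inPlace : ∀ ε t a i j → toℕ j ≡ toℕ i ℕ.+ t → contributionAt ε t a i j ≈ power a i
  contributionAt-inPlace ε t a i j j≡i+t with inPlace? t i j
  ... | yes _    = refl
  ... | no j≢i+t = ⊥-elim (j≢i+t j≡i+t)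

  contributionAt₀-displaced : ∀ t a i j → toℕ j ≢ toℕ i ℕ.+ t → contributionAt 0# t a i j ≈ 0#
  contributionAt₀-displaced t a i j j≢i+t with inPlace? t i j | wrapped? t i j
  ... | yes j≡i+t | _     = ⊥-elim (j≢i+t j≡i+t)
  ... | no _      | yes _ = zeroˡ _
  ... | no _      | no _  = refl

  wrapPartAt-unwrapped : ∀ t a i j → toℕ j ℕ.+ k ≢ toℕ i ℕ.+ t → wrapPartAt t a i j ≈ 0#
  wrapPartAt-unwrapped t a i j unwrapped with inPlace? t i j | wrapped? t i j
  ... | yes _ | _      = refl
  ... | no _  | yes wr = ⊥-elim (unwrapped wr)
  ... | no _  | no _   = refl

  wrapPartAt-wrapped : ∀ t a i j → toℕ j ≢ toℕ i ℕ.+ t → toℕ j ℕ.+ k ≡ toℕ i ℕ.+ t → wrapPartAt t a i j ≈ power a i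
  wrapPartAt-wrapped t a i j j≢i+t wr with inPlace? t i j | wrapped? t i j
  ... | yes j≡i+t | _            = ⊥-elim (j≢i+t j≡i+t)
  ... | no _      | yes _        = refl
  ... | no _      | no unwrapped = ⊥-elim (unwrapped wr)

  U W : Matrix k
  U i j = sum₃ (λ t a → contributionAt 0# t a i j)
  W i j = sum₃ (λ t a → wrapPartAt t a i j)

  -- Dmat's `term` is local and cannot be named, hence the run through all 27 outcomes of its tests.
  Dmat-≡ : ∀ ε i j → Dmat F q k ε a₀ a₁ a₂ i j ≡ sum₃ (λ t a → contributionAt ε t a i j)
  Dmat-≡ ε i j
    with toℕ j ≟ toℕ i ℕ.+ 0 | toℕ j ℕ.+ k ≟ toℕ i ℕ.+ 0
       | toℕ j ≟ toℕ i ℕ.+ 1 | toℕ j ℕ.+ k ≟ toℕ i ℕ.+ 1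
       | toℕ j ≟ toℕ i ℕ.+ 2 | toℕ j ℕ.+ k ≟ toℕ i ℕ.+ 2
  ... | yes _ | _     | yes _ | _     | yes _ | _     = ≡.refl
  ... | yes _ | _     | yes _ | _     | no _  | yes _ = ≡.refl
  ... | yes _ | _     | yes _ | _     | no _  | no _  = ≡.refl
  ... | yes _ | _     | no _  | yes _ | yes _ | _     = ≡.refl
  ... | yes _ | _     | no _  | yes _ | no _  | yes _ = ≡.refl
  ... | yes _ | _     | no _  | yes _ | no _  | no _  = ≡.refl
  ... | yes _ | _     | no _  | no _  | yes _ | _     = ≡.refl
  ... | yes _ | _     | no _  | no _  | no _  | yes _ = ≡.refl
  ... | yes _ | _     | no _  | no _  | no _  | no _  = ≡.refl
  ... | no _  | yes _ | yes _ | _     | yes _ | _     = ≡.refl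
  ... | no _  | yes _ | yes _ | _     | no _  | yes _ = ≡.refl
  ... | no _  | yes _ | yes _ | _     | no _  | no _  = ≡.refl
  ... | no _  | yes _ | no _  | yes _ | yes _ | _     = ≡.refl
  ... | no _  | yes _ | no _  | yes _ | no _  | yes _ = ≡.refl
  ... | no _  | yes _ | no _  | yes _ | no _  | no _  = ≡.refl
  ... | no _  | yes _ | no _  | no _  | yes _ | _     = ≡.refl
  ... | no _  | yes _ | no _  | no _  | no _  | yes _ = ≡.refl
  ... | no _  | yes _ | no _  | no _  | no _  | no _  = ≡.refl
  ... | no _  | no _  | yes _ | _     | yes _ | _     = ≡.refl
  ... | no _  | no _  | yes _ | _     | no _  | yes _ = ≡.refl
  ... | no _  | no _  | yes _ | _     | no _  | no _  = ≡.refl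
  ... | no _  | no _  | no _  | yes _ | yes _ | _     = ≡.refl
  ... | no _  | no _  | no _  | yes _ | no _  | yes _ = ≡.refl
  ... | no _  | no _  | no _  | yes _ | no _  | no _  = ≡.refl
  ... | no _  | no _  | no _  | no _  | yes _ | _     = ≡.refl
  ... | no _  | no _  | no _  | no _  | no _  | yes _ = ≡.refl
  ... | no _  | no _  | no _  | no _  | no _  | no _  = ≡.refl

  Dmat≈U+εW : ∀ ε i j → Dmat F q k ε a₀ a₁ a₂ i j ≈ U i j + ε * W i j
  Dmat≈U+εW ε i j = begin
    Dmat F q k ε a₀ a₁ a₂ i j
      ≡⟨ Dmat-≡ ε i j ⟩
    sum₃ (λ t a → contributionAt ε t a i j)
      ≈⟨ +-cong (split 0 a₀) (+-cong (split 1 a₁) (split 2 a₂)) ⟩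
    sum₃ (λ t a → contributionAt 0# t a i j + ε * wrapPartAt t a i j)
      ≈⟨ regroup _ _ _ _ _ _ ε ⟩
    U i j + ε * W i j
      ∎
    where
    split : ∀ t a → contributionAt ε t a i j ≈ contributionAt 0# t a i j + ε * wrapPartAt t a i j
    split t a = contributionAt-split ε t a i j

    regroup : ∀ u₀ u₁ u₂ w₀ w₁ w₂ ε →
              (u₀ + ε * w₀) + ((u₁ + ε * w₁) + (u₂ + ε * w₂)) ≈ (u₀ + (u₁ + u₂)) + ε * (w₀ + (w₁ + w₂))
    regroup = solve 7 (λ u₀ u₁ u₂ w₀ w₁ w₂ ε →
      (u₀ :+ ε :* w₀) :+ ((u₁ :+ ε :* w₁) :+ (u₂ :+ ε :* w₂)) := (u₀ :+ (u₁ :+ u₂)) :+ ε :* (w₀ :+ (w₁ :+ w₂))) refl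

  U-≈0 : ∀ i j → (∀ t → t ≤ 2 → toℕ j ≢ toℕ i ℕ.+ t) → U i j ≈ 0#
  U-≈0 i j displaced = sum₃-≈0 λ t a t≤2 →
    contributionAt₀-displaced t a i j (displaced t t≤2)

  W-≈0 : ∀ i j → (∀ t → t ≤ 2 → toℕ j ℕ.+ k ≢ toℕ i ℕ.+ t) → W i j ≈ 0#
  W-≈0 i j unwrapped = sum₃-≈0 λ t a t≤2 →
    wrapPartAt-unwrapped t a i j (unwrapped t t≤2)

  U-diagonal : ∀ i → U i i ≈ power a₀ i
  U-diagonal i =
    trans (+-cong (contributionAt-inPlace 0# 0 a₀ i i i≡i+0)
                  (+-cong (contributionAt₀-displaced 1 a₁ i i (other-offset (toℕ i) 0 1 i≡i+0 (λ ())))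
                          (contributionAt₀-displaced 2 a₂ i i (other-offset (toℕ i) 0 2 i≡i+0 (λ ())))))
          (trans (+-congˡ (+-identityˡ 0#)) (+-identityʳ _))
    where
    i≡i+0 : toℕ i ≡ toℕ i ℕ.+ 0
    i≡i+0 = ≡.sym (ℕₚ.+-identityʳ (toℕ i))

  U-superdiagonal₂ : ∀ i j → toℕ j ≡ toℕ i ℕ.+ 2 → U i j ≈ power a₂ i
  U-superdiagonal₂ i j j≡i+2 =
    trans (+-cong (contributionAt₀-displaced 0 a₀ i j (other-offset (toℕ i) 2 0 j≡i+2 (λ ())))
                  (+-cong (contributionAt₀-displaced 1 a₁ i j (other-offset (toℕ i) 2 1 j≡i+2 (λ ())))
                          (contributionAt-inPlace 0# 2 a₂ i j j≡i+2)))
          (trans (+-identityˡ _) (+-identityˡ _))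

  W-wrapped₂ : ∀ i j → toℕ j ℕ.+ k ≡ toℕ i ℕ.+ 2 → W i j ≈ power a₂ i
  W-wrapped₂ i j j+k≡i+2 =
    trans (+-cong (wrapPartAt-unwrapped 0 a₀ i j (other-offset (toℕ i) 2 0 j+k≡i+2 (λ ())))
                  (+-cong (wrapPartAt-unwrapped 1 a₁ i j (other-offset (toℕ i) 2 1 j+k≡i+2 (λ ())))
                          (wrapPartAt-wrapped 2 a₂ i j not-inPlace j+k≡i+2)))
          (trans (+-identityˡ _) (+-identityˡ _))
    where
    not-inPlace : toℕ j ≢ toℕ i ℕ.+ 2
    not-inPlace j≡i+2 = ℕₚ.m+1+n≢m (toℕ j) (≡.trans j+k≡i+2 (≡.sym j≡i+2))

  W-beyond-column₁ : ∀ i j → 2 ≤ toℕ j → W i j ≈ 0#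
  W-beyond-column₁ i j 2≤j = W-≈0 i j λ t t≤2 →
    beyond-reach t≤2 (ℕₚ.<-≤-trans (s≤s (s≤s (toℕ<n i))) (ℕₚ.+-monoˡ-≤ k 2≤j))

  U-upper-triangular : ∀ i j → toℕ j < toℕ i → U i j ≈ 0#
  U-upper-triangular i j j<i = U-≈0 i j λ t _ → before-reach t j<i

  Dε : Carrier → Matrix k
  Dε ε = withColumns₀₁ U (λ i → U i fzero + ε * W i fzero) (λ i → U i (fsuc fzero) + ε * W i (fsuc fzero))

  Dmat≈Dε : ∀ ε i j → Dmat F q k ε a₀ a₁ a₂ i j ≈ Dε ε i j
  Dmat≈Dε ε i fzero              = Dmat≈U+εW ε i fzero
  Dmat≈Dε ε i (fsuc fzero)       = Dmat≈U+εW ε i (fsuc fzero)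
  Dmat≈Dε ε i (fsuc (fsuc j))    = trans (Dmat≈U+εW ε i (fsuc (fsuc j)))
    (trans (+-congˡ (trans (*-congˡ (W-beyond-column₁ i (fsuc (fsuc j)) (s≤s (s≤s z≤n)))) (zeroʳ ε))) (+-identityʳ _))

  E : Matrix k
  E = withColumns₀₁ U (λ i → W i fzero) (λ i → W i (fsuc fzero))

  linear-coefficient : Carrier
  linear-coefficient = det F k (withColumns₀₁ U (λ i → W i fzero) (λ i → U i (fsuc fzero)))
                     + det F k (withColumns₀₁ U (λ i → U i fzero) (λ i → W i (fsuc fzero)))

  det-Dmat-quadratic : ∀ ε → det F k (Dmat F q k ε a₀ a₁ a₂) ≈ det F k U + ε * linear-coefficient + (ε * ε) * det F k E
  det-Dmat-quadratic ε =
    trans (det-cong k (Dmat≈Dε ε))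
          (trans (det-affine-in-columns₀₁ U _ _ _ _ ε)
                 (+-congʳ (+-congʳ (det-cong k (λ i j → reflexive (withColumns₀₁-own U i j))))))

  det-U : det F k U ≈ norm F q k a₀
  det-U = trans (det-upper-triangular k U-upper-triangular)
                (trans (prodFin-cong k U-diagonal) (sym (norm≈prodFin q k a₀)))

  det-E : det F k E ≈ norm F q k a₂
  det-E = trans (det-rotated-lower-triangular (suc m) {E} (power a₂) above pivot) (sym (norm≈prodFin q k a₂))
    where
    above : ∀ i j → toℕ i < rotatedTwice j → E i j ≈ 0#
    above i fzero           i<m+1 = W-≈0 i fzero λ t t≤2 → beyond-reach t≤2 (s≤s (s≤s i<m+1))
    above i (fsuc fzero)    i<m+2 = W-≈0 i (fsuc fzero) λ t t≤2 → beyond-reach t≤2 (s≤s (s≤s i<m+2))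
    above i (fsuc (fsuc j)) i<j   = U-≈0 i (fsuc (fsuc j)) λ t t≤2 → beyond-reach t≤2 (s≤s (s≤s i<j))
    pivot : ∀ i j → rotatedTwice j ≡ toℕ i → E i j ≈ power a₂ i
    pivot i fzero           m+1≡i = W-wrapped₂ i fzero (two-further m+1≡i)
    pivot i (fsuc fzero)    m+2≡i = W-wrapped₂ i (fsuc fzero) (two-further m+2≡i)
    pivot i (fsuc (fsuc j)) j≡i   = U-superdiagonal₂ i (fsuc (fsuc j)) (two-further j≡i)

lemma2p3 : {c ℓ : Level} (F : CommutativeRing c ℓ) (q k : ℕ) →
           IsPrimePower q → 3 ≤ k → IsField F → HasCardinality F (q ^ k) →
           (a₀ a₁ a₂ : CommutativeRing.Carrier F) →
           let open CommutativeRing F in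
           (det F k (Dmat F q k 1# a₀ a₁ a₂) + det F k (Dmat F q k (- 1#) a₀ a₁ a₂))
             ≈ ((1# + 1#) * (norm F q k a₀ + norm F q k a₂))
lemma2p3 F q k _ (s≤s (s≤s (s≤s {n = m} _))) _ _ a₀ a₁ a₂ = begin
  det F k (Dmat F q k 1# a₀ a₁ a₂) + det F k (Dmat F q k (- 1#) a₀ a₁ a₂)
    ≈⟨ +-cong (det-Dmat-quadratic 1#) (det-Dmat-quadratic (- 1#)) ⟩
  (det F k U + 1# * linear-coefficient + (1# * 1#) * det F k E)
    + (det F k U + - 1# * linear-coefficient + (- 1# * - 1#) * det F k E)
    ≈⟨ sum-at-±1 _ _ _ ⟩
  (1# + 1#) * (det F k U + det F k E)
    ≈⟨ *-congˡ (+-cong det-U det-E) ⟩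
  (1# + 1#) * (norm F q k a₀ + norm F q k a₂)
    ∎
  where
  open CommutativeRing F hiding (zero)
  open SetoidReasoning setoid
  open DMatrix F q m a₀ a₁ a₂ hiding (k)
  open Signs F
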